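{- Let $T$ be a tree with at least two vertices. Then $sp(T)=\Delta(T)$ if and only if there exist a star $T_0=K_{1,m}$ ($m\ge 1$) and trees $T_0,T_1,\dots,T_r=T$ ($r\ge 0$) such that for each $i=0,\dots,r-1$: $|V(T_i)|\ge 3$, $p_i:=sp(T_i)=\Delta(T_i)\ge 2$, and $T_{i+1}$ is obtained from $T_i$ and the star $K_{1,p_i}$ by identifying a degree-one vertex of $K_{1,p_i}$ with some vertex of $B(T_i)$.
   Context: For a tree $S$, $\Delta(S)$ is its maximum degree and $B(S)=\{v\in V(S): d_S(v)<\Delta(S)\}$. For a graph $G$ without isolated vertices, $sp(G)$ is the least integer $k$ such that $G$ has a subgraph $H$ with $V(H)=V(G)$ and $1\le d_H(x)\le k$ for all vertices $x$ (equivalently, the least $k$ such that $G$ has a $k$-edge-colorable subgraph in which every vertex has degree at least $1$). -}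

module Defs where

open import Data.Bool using (Bool; true; false; if_then_else_)
open import Data.Nat using (ℕ; zero; suc; _+_; _≤_; _<_; _⊔_)
open import Data.Fin using (Fin; zero; suc; splitAt; _≟_)
open import Data.Sum using (_⊎_; inj₁; inj₂)
open import Data.List using (List; []; _∷_; length; map; foldr; allFin; _∷ʳ_)
open import Data.Nat.ListAction using (sum)
open import Data.List.Relation.Unary.Unique.Propositional using (Unique)
open import Data.List.Relation.Unary.Linked using (Linked)
open import Data.Product using (Σ; _×_; _,_)
open import Data.Empty using (⊥)
open import Relation.Nullary using (¬_; does)
open import Relation.Binary.PropositionalEquality using (_≡_)

Adj : ℕ → Set
Adj n = Fin n → Fin n → Bool

Edge : ∀ {n} → Adj n → Fin n → Fin n → Set
Edge A u v = A u v ≡ true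

IsSimple : ∀ {n} → Adj n → Set
IsSimple A = (∀ u v → A u v ≡ A v u) × (∀ v → A v v ≡ false)

deg : ∀ {n} → Adj n → Fin n → ℕ
deg {n} A v = sum (map (λ u → if A v u then 1 else 0) (allFin n))

Δ : ∀ {n} → Adj n → ℕ
Δ {n} A = foldr _⊔_ 0 (map (deg A) (allFin n))

InB : ∀ {n} → Adj n → Fin n → Set
InB A v = deg A v < Δ A

data Walk {n} (A : Adj n) : Fin n → Fin n → Set where
  here : ∀ {u} → Walk A u u
  step : ∀ {u w v} → Edge A u w → Walk A w v → Walk A u v

Connected : ∀ {n} → Adj n → Set
Connected A = ∀ u v → Walk A u v

Cycle : ∀ {n} → Adj n → Set
Cycle {n} A = Σ (Fin n) λ x → Σ (List (Fin n)) λ xs →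
  (3 ≤ length (x ∷ xs)) × Unique (x ∷ xs) × Linked (Edge A) ((x ∷ xs) ∷ʳ x)

Acyclic : ∀ {n} → Adj n → Set
Acyclic A = ¬ Cycle A

IsTree : ∀ {n} → Adj n → Set
IsTree A = IsSimple A × Connected A × Acyclic A

IsSpanningSubgraph : ∀ {n} → Adj n → Adj n → Set
IsSpanningSubgraph G H = (∀ u v → H u v ≡ H v u) × (∀ u v → Edge H u v → Edge G u v)

HasSpanning : ∀ {n} → Adj n → ℕ → Set
HasSpanning {n} G k = Σ (Adj n) λ H → IsSpanningSubgraph G H ×
  (∀ x → 1 ≤ deg H x × deg H x ≤ k)

IsSp : ∀ {n} → Adj n → ℕ → Set
IsSp G k = HasSpanning G k × (∀ j → HasSpanning G j → k ≤ j)

record Iso {n m} (A : Adj n) (B : Adj m) : Set where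
  field
    to       : Fin n → Fin m
    from     : Fin m → Fin n
    to-from  : ∀ y → to (from y) ≡ y
    from-to  : ∀ x → from (to x) ≡ x
    preserve : ∀ u v → A u v ≡ B (to u) (to v)

star : (m : ℕ) → Adj (suc m)
star m zero    zero    = false
star m zero    (suc _) = true
star m (suc _) zero    = true
star m (suc _) (suc _) = false

-- identify a leaf of K_{1,p} with v of G.  The new vertices are Fin p placed after
-- Fin n: new vertex 0 is the centre of the star, adjacent to v and to the other
-- p - 1 new vertices (the remaining leaves).
attachAdj : ∀ {n p} (A : Adj n) (v : Fin n) → (Fin n ⊎ Fin p) → (Fin n ⊎ Fin p) → Bool
attachAdj A v (inj₁ a) (inj₁ b) = A a b
attachAdj A v (inj₁ a) (inj₂ zero) = does (a ≟ v)
attachAdj A v (inj₂ zero) (inj₁ b) = does (b ≟ v)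
attachAdj A v (inj₂ zero) (inj₂ (suc _)) = true
attachAdj A v (inj₂ (suc _)) (inj₂ zero) = true
attachAdj A v _ _ = false

attach : ∀ {n} (A : Adj n) (v : Fin n) (p : ℕ) → Adj (n + p)
attach {n} A v p x y = attachAdj {n} {p} A v (splitAt n x) (splitAt n y)

-- Built A : there are trees T₀ = K_{1,m} (m ≥ 1), T₁, …, T_r ≅ A with the
-- properties of the theorem (the sequence is encoded by this inductive derivation).
data Built : ∀ {n} → Adj n → Set where
  base : ∀ {n} {A : Adj n} (m : ℕ) → 1 ≤ m → IsTree A → Iso A (star m) → Built A
  grow : ∀ {n n'} {A : Adj n} {A' : Adj n'} → Built A →
         3 ≤ n → (p : ℕ) → IsSp A p → Δ A ≡ p → 2 ≤ p →
         (v : Fin n) → InB A v →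
         IsTree A' → Iso A' (attach A v p) → Built A'

module Submission where

-- (⇐) A star K_{1,m} has sp = Δ = m.  If sp(T) = Δ(T) = p ≥ 2 and v ∈ B(T),
-- then attaching K_{1,p} at v gives a tree with Δ = p (the new centre has
-- degree p, v's degree grows by one) and sp = p: a witness for T extends by
-- the star, and conversely in any witness for the new tree the new leaves
-- force all p star edges at the centre, so either the centre–v edge is used
-- too (degree ≥ p + 1 there) or the witness restricts to one for T.
--
-- (⇒) By strong induction on |V(T)|.  Let ℓ(w) be the number of leaf
-- neighbours of w.  Root T; keeping all leaf edges plus one child edge at each
-- non-leaf vertex without leaf neighbours gives sp(T) ≤ E whenever E ≥ 2 and
-- ℓ(w) + 1 ≤ E for all w.  So sp(T) = Δ(T) = D yields a "good" vertex c with
-- d(c) = D and ℓ(c) ≥ D - 1.  If every neighbour of c is a leaf, T is the star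
-- K_{1,D}.  Otherwise c has exactly one non-leaf neighbour v; deleting c and
-- its leaves leaves a smaller tree T′ with sp(T′) = Δ(T′) = D and v ∈ B(T′),
-- and T is T′ with K_{1,D} attached at v.

open import Defs
open import Data.Nat using (ℕ; _≤_)
open import Function.Bundles using (_⇔_; mk⇔)

open import Data.Bool using (Bool; true; false; if_then_else_; _∧_; _∨_; not)
open import Data.Bool.Properties using (¬-not; ∨-assoc; ∨-comm; ∨-zeroʳ; ∧-zeroʳ)
open import Data.Nat using (zero; suc; _+_; _<_; _⊔_; pred; z≤n; s≤s)
open import Data.Nat.Properties hiding (_≟_)
open import Data.Fin using (Fin; zero; suc; _≟_; splitAt; join; _↑ˡ_; _↑ʳ_)
open import Data.Fin.Properties using (any?; injective⇒≤; splitAt-join; join-splitAt; splitAt⁻¹-↑ˡ; splitAt⁻¹-↑ʳ)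
  renaming (suc-injective to fsuc-injective)
open import Data.Sum using (_⊎_; inj₁; inj₂)
open import Data.Product using (Σ; _×_; _,_; ∃; proj₁; proj₂)
open import Data.Empty using (⊥-elim)
open import Data.List using (List; []; _∷_; _++_; _∷ʳ_; map; allFin; tabulate; lookup; filter; length)
open import Data.List.Properties using (map-tabulate; foldr-preservesᵇ; foldr-preservesᵒ; length-map; length-++; map-++; ++-assoc)
open import Data.List.Relation.Unary.Unique.Propositional using (Unique)
import Data.List.Relation.Unary.Unique.Propositional.Properties as Unique
open import Data.List.Relation.Unary.AllPairs using ([]; _∷_)
open import Data.List.Relation.Unary.Linked using (Linked; [-]; _∷_)
import Data.List.Relation.Unary.Linked.Properties as Linked
open import Data.List.Relation.Unary.Any.Properties using (lookup-index)
import Data.List.Relation.Unary.All as All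
import Data.List.Relation.Unary.All.Properties as All
import Data.List.Relation.Unary.Any as Any
open import Data.List.Membership.Propositional using (_∈_)
import Data.List.Membership.DecPropositional as DecMembership
open import Data.List.Membership.Propositional.Properties using (∈-map⁺; ∈-allFin; ∈-lookup; ∈-filter⁺; ∈-filter⁻; ∈-∃++)
import Data.Nat.ListAction as ListAction
import Data.Fin.Permutation as Permutation
import Data.Bool as Bool
import Data.Nat as Nat
open import Algebra.Properties.CommutativeMonoid.Sum +-0-commutativeMonoid
  using (sum-cong-≗; ∑-distrib-+; ∑-permute) renaming (sum to ∑)
open import Relation.Nullary using (¬_; Dec; does; yes; no)
open import Relation.Nullary.Decidable using (dec-true; dec-false; _×-dec_; ¬?)
open import Relation.Binary.PropositionalEquality
open import Function using (_∘_)
open import Data.Nat.Induction using (<-rec)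

∑-mono : ∀ {n} {f g : Fin n → ℕ} → (∀ i → f i ≤ g i) → ∑ f ≤ ∑ g
∑-mono {zero} h = z≤n
∑-mono {suc n} h = +-mono-≤ (h zero) (∑-mono (h ∘ suc))

∑-point : ∀ {n} (f : Fin n → ℕ) a → f a ≤ ∑ f
∑-point f zero = m≤m+n _ _
∑-point f (suc a) = ≤-trans (∑-point (f ∘ suc) a) (m≤n+m _ _)

∑-two : ∀ {n} (f : Fin n → ℕ) a b → ¬ a ≡ b → f a + f b ≤ ∑ f
∑-two f zero zero a≢b = ⊥-elim (a≢b refl)
∑-two f zero (suc b) _ = +-monoʳ-≤ (f zero) (∑-point (f ∘ suc) b)
∑-two f (suc a) zero _ = subst (_≤ ∑ f) (+-comm (f zero) _) (+-monoʳ-≤ (f zero) (∑-point (f ∘ suc) a))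
∑-two f (suc a) (suc b) a≢b = ≤-trans (∑-two (f ∘ suc) a b (a≢b ∘ cong suc)) (m≤n+m _ _)

∑-zero : ∀ {n} (f : Fin n → ℕ) → (∀ i → f i ≡ 0) → ∑ f ≡ 0
∑-zero {zero} f h = refl
∑-zero {suc n} f h rewrite h zero = ∑-zero (f ∘ suc) (h ∘ suc)

∑-ones : ∀ n → ∑ {n} (λ _ → 1) ≡ n
∑-ones zero = refl
∑-ones (suc n) = cong suc (∑-ones n)

∑-single : ∀ {n} (a : Fin n) (f : Fin n → ℕ) → (∀ i → ¬ i ≡ a → f i ≡ 0) → ∑ f ≡ f a
∑-single zero f h = trans (cong (f zero +_) (∑-zero (f ∘ suc) (λ i → h (suc i) (λ ())))) (+-identityʳ _)
∑-single (suc a) f h rewrite h zero (λ ()) = ∑-single a (f ∘ suc) (λ i i≢a → h (suc i) (i≢a ∘ fsuc-injective))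

∑-pos : ∀ {n} (f : Fin n → ℕ) → 1 ≤ ∑ f → ∃ λ i → 1 ≤ f i
∑-pos {suc n} f h with f zero in eq
... | suc _ = zero , subst (1 ≤_) (sym eq) (s≤s z≤n)
... | zero with ∑-pos (f ∘ suc) h
... | i , p = suc i , p

∑-below : ∀ {n} (f : Fin n → ℕ) → (∀ i → f i ≤ 1) → ∀ a → f a ≡ 0 → ∑ f < n
∑-below f h zero fa≡0 rewrite fa≡0 = s≤s (≤-trans (∑-mono (h ∘ suc)) (≤-reflexive (∑-ones _)))
∑-below {suc n} f h (suc a) fa≡0 =
  subst (_≤ suc n) (+-suc (f zero) _) (+-mono-≤ (h zero) (∑-below (f ∘ suc) (h ∘ suc) a fa≡0))

∑-split : ∀ m n (f : Fin (m + n) → ℕ) →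
  ∑ f ≡ ∑ (λ i → f (i ↑ˡ n)) + ∑ (λ i → f (m ↑ʳ i))
∑-split zero n f = refl
∑-split (suc m) n f = trans (cong (f zero +_) (∑-split m n (f ∘ suc))) (sym (+-assoc (f zero) _ _))

𝟙 : Bool → ℕ
𝟙 b = if b then 1 else 0

𝟙≤1 : ∀ b → 𝟙 b ≤ 1
𝟙≤1 true = s≤s z≤n
𝟙≤1 false = z≤n

does-true : ∀ {A : Set} (a? : Dec A) → does a? ≡ true → A
does-true (yes a) _ = a

does-false : ∀ {A : Set} (a? : Dec A) → does a? ≡ false → ¬ A
does-false (no ¬a) _ = ¬a

does-refl : ∀ {n} (i : Fin n) → does (i ≟ i) ≡ true
does-refl i = dec-true (i ≟ i) refl

does-≢ : ∀ {n} {i j : Fin n} → ¬ i ≡ j → does (i ≟ j) ≡ false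
does-≢ {i = i} {j} = dec-false (i ≟ j)

false≢true : ¬ false ≡ true
false≢true ()

∧-true : ∀ {a b} → (a ∧ b) ≡ true → a ≡ true × b ≡ true
∧-true {true} e = refl , e

∨-true : ∀ {a b} → (a ∨ b) ≡ true → a ≡ true ⊎ b ≡ true
∨-true {true} _ = inj₁ refl
∨-true {false} e = inj₂ e

by-cases : ∀ {P : Set} b → (b ≡ true → P) → (b ≡ false → P) → P
by-cases true t f = t refl
by-cases false t f = f refl

𝟙-bound : ∀ {b k} → (b ≡ true → 1 ≤ k) → 𝟙 b ≤ k
𝟙-bound {true} h = h refl
𝟙-bound {false} h = z≤n

𝟙-true : ∀ {b} → b ≡ true → 1 ≤ 𝟙 b
𝟙-true refl = ≤-refl

𝟙-true⁻¹ : ∀ {b} → 1 ≤ 𝟙 b → b ≡ true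
𝟙-true⁻¹ {true} _ = refl

∑-indicator : ∀ {n} (w : Fin n) → ∑ (λ i → 𝟙 (does (i ≟ w))) ≡ 1
∑-indicator w = trans (∑-single w _ (λ i i≢w → cong 𝟙 (does-≢ i≢w))) (cong 𝟙 (does-refl w))

∑-nothing : ∀ m → ∑ {m} (λ _ → 𝟙 false) ≡ 0
∑-nothing m = ∑-zero {m} (λ _ → 𝟙 false) (λ _ → refl)

listSum-tabulate : ∀ {n} (f : Fin n → ℕ) → ListAction.sum (tabulate f) ≡ ∑ f
listSum-tabulate {zero} f = refl
listSum-tabulate {suc n} f = cong (f zero +_) (listSum-tabulate (f ∘ suc))

deg-∑ : ∀ {n} (A : Adj n) v → deg A v ≡ ∑ (λ u → 𝟙 (A v u))
deg-∑ {n} A v = trans (cong ListAction.sum (map-tabulate {n = n} (λ x → x) (λ u → 𝟙 (A v u))))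
                      (listSum-tabulate (λ u → 𝟙 (A v u)))

deg≤Δ : ∀ {n} (A : Adj n) v → deg A v ≤ Δ A
deg≤Δ {n} A v = foldr-preservesᵒ {P = deg A v ≤_} below-⊔
  0 (map (deg A) (allFin n)) (inj₂ (Any.map ≤-reflexive (∈-map⁺ (deg A) (∈-allFin v))))
  where
  below-⊔ : ∀ x y → deg A v ≤ x ⊎ deg A v ≤ y → deg A v ≤ x ⊔ y
  below-⊔ x y (inj₁ p) = ≤-trans p (m≤m⊔n x y)
  below-⊔ x y (inj₂ p) = ≤-trans p (m≤n⊔m x y)

Δ-lub : ∀ {n} (A : Adj n) k → (∀ v → deg A v ≤ k) → Δ A ≤ k
Δ-lub {n} A k h = foldr-preservesᵇ {P = _≤ k} ⊔-lub z≤n (All.map⁺ (All.universal h (allFin n)))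

deg-cong : ∀ {n} (A B : Adj n) v w → (∀ u → A v u ≡ B w u) → deg A v ≡ deg B w
deg-cong A B v w h = trans (deg-∑ A v) (trans (sum-cong-≗ (λ u → cong 𝟙 (h u))) (sym (deg-∑ B w)))

edge⇒deg≥1 : ∀ {n} (A : Adj n) v u → Edge A v u → 1 ≤ deg A v
edge⇒deg≥1 A v u e = subst (1 ≤_) (sym (deg-∑ A v))
  (≤-trans (subst (λ b → 1 ≤ 𝟙 b) (sym e) ≤-refl) (∑-point (λ u → 𝟙 (A v u)) u))

deg≥1⇒edge : ∀ {n} (A : Adj n) v → 1 ≤ deg A v → ∃ λ u → Edge A v u
deg≥1⇒edge A v h with ∑-pos (λ u → 𝟙 (A v u)) (subst (1 ≤_) (deg-∑ A v) h)
... | u , p with A v u in e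
... | true = u , e

deg≤1-unique : ∀ {n} (A : Adj n) a {x y} → deg A a ≤ 1 → Edge A a x → Edge A a y → x ≡ y
deg≤1-unique A a {x} {y} d ex ey with x ≟ y
... | yes x≡y = x≡y
... | no x≢y = ⊥-elim (1+n≰n (begin
  2                           ≡⟨ cong₂ _+_ (cong 𝟙 (sym ex)) (cong 𝟙 (sym ey)) ⟩
  𝟙 (A a x) + 𝟙 (A a y)       ≤⟨ ∑-two (λ u → 𝟙 (A a u)) x y x≢y ⟩
  ∑ (λ u → 𝟙 (A a u))         ≡⟨ deg-∑ A a ⟨
  deg A a                     ≤⟨ d ⟩
  1                           ∎))
  where open ≤-Reasoning

unique⇒deg≤1 : ∀ {n} (A : Adj n) x w → (∀ z → Edge A x z → z ≡ w) → deg A x ≤ 1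
unique⇒deg≤1 A x w only = subst (_≤ 1) (sym (deg-∑ A x))
  (≤-trans (∑-mono below) (≤-reflexive (∑-indicator w)))
  where
  below : ∀ z → 𝟙 (A x z) ≤ 𝟙 (does (z ≟ w))
  below z with A x z in e
  ... | false = z≤n
  ... | true rewrite only z e = ≤-reflexive (cong 𝟙 (sym (does-refl w)))

deg-mono : ∀ {n} (H A : Adj n) w → (∀ u → Edge H w u → Edge A w u) → deg H w ≤ deg A w
deg-mono H A w H⊆A = subst₂ _≤_ (sym (deg-∑ H w)) (sym (deg-∑ A w))
  (∑-mono (λ u → 𝟙-bound (λ e → 𝟙-true (H⊆A u e))))

deg<order : ∀ {n} (A : Adj n) → IsSimple A → ∀ a → deg A a < n
deg<order A (_ , loopless) a = subst (_< _) (sym (deg-∑ A a))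
  (∑-below (λ u → 𝟙 (A a u)) (λ u → 𝟙≤1 (A a u)) a (cong 𝟙 (loopless a)))

Iso-sym : ∀ {n m} {A : Adj n} {B : Adj m} → Iso A B → Iso B A
Iso-sym {B = B} I = record
  { to = from ; from = to ; to-from = from-to ; from-to = to-from
  ; preserve = λ u v → sym (trans (preserve (from u) (from v)) (cong₂ B (to-from u) (to-from v))) }
  where open Iso I

module _ {n m} {A : Adj n} {B : Adj m} (I : Iso A B) where
  open Iso I

  deg-pullback : ∀ (H : Adj m) x → deg (λ u w → H (to u) (to w)) x ≡ deg H (to x)
  deg-pullback H x = begin
    deg (λ u w → H (to u) (to w)) x  ≡⟨ deg-∑ (λ u w → H (to u) (to w)) x ⟩
    ∑ (λ u → 𝟙 (H (to x) (to u)))    ≡⟨ ∑-permute (λ z → 𝟙 (H (to x) z)) (Permutation.permutation to from to-from from-to) ⟨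
    ∑ (λ z → 𝟙 (H (to x) z))         ≡⟨ deg-∑ H (to x) ⟨
    deg H (to x)                     ∎
    where open ≡-Reasoning

  deg-iso : ∀ x → deg A x ≡ deg B (to x)
  deg-iso x = trans (deg-cong A (λ u w → B (to u) (to w)) x x (preserve x)) (deg-pullback B x)

  Δ-iso : Δ A ≡ Δ B
  Δ-iso = ≤-antisym
    (Δ-lub A (Δ B) (λ x → subst (_≤ Δ B) (sym (deg-iso x)) (deg≤Δ B (to x))))
    (Δ-lub B (Δ A) (λ y → subst (_≤ Δ A) (trans (deg-iso (from y)) (cong (deg B) (to-from y))) (deg≤Δ A (from y))))

  HasSpanning-iso : ∀ k → HasSpanning B k → HasSpanning A k
  HasSpanning-iso k (H , (sym-H , H⊆B) , bounds) =
    (λ u w → H (to u) (to w)) ,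
    ((λ u w → sym-H (to u) (to w)) , (λ u w e → trans (preserve u w) (H⊆B (to u) (to w) e))) ,
    λ x → subst (λ d → 1 ≤ d × d ≤ k) (sym (deg-pullback H x)) (bounds (to x))

IsSp-iso : ∀ {n m} {A : Adj n} {B : Adj m} → Iso A B → ∀ k → IsSp B k → IsSp A k
IsSp-iso I k (has , least) = HasSpanning-iso I k has , λ j h → least j (HasSpanning-iso (Iso-sym I) j h)

forced-edge : ∀ {n} {G H : Adj n} → IsSpanningSubgraph G H → ∀ {x y} →
  (∀ u → Edge G x u → u ≡ y) → 1 ≤ deg H x → Edge H x y
forced-edge {H = H} (_ , H⊆G) {x} only d with deg≥1⇒edge H x d
... | u , e = subst (Edge H x) (only u (H⊆G x u e)) e

HasSpanning-Δ : ∀ {n} (A : Adj n) → IsSimple A → (∀ v → 1 ≤ deg A v) → HasSpanning A (Δ A)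
HasSpanning-Δ A (sym-A , _) d = A , (sym-A , λ u v e → e) , λ x → d x , deg≤Δ A x

deg-star-centre : ∀ m → deg (star m) zero ≡ m
deg-star-centre m = trans (deg-∑ (star m) zero) (∑-ones m)

deg-star-leaf : ∀ m i → deg (star m) (suc i) ≡ 1
deg-star-leaf m i = trans (deg-∑ (star m) (suc i)) (cong suc (∑-zero {m} (λ u → 𝟙 (star m (suc i) (suc u))) (λ _ → refl)))

Δ-star : ∀ m → 1 ≤ m → Δ (star m) ≡ m
Δ-star m m≥1 = ≤-antisym (Δ-lub (star m) m bound)
  (subst (_≤ Δ (star m)) (deg-star-centre m) (deg≤Δ (star m) zero))
  where
  bound : ∀ v → deg (star m) v ≤ m
  bound zero = ≤-reflexive (deg-star-centre m)
  bound (suc i) = subst (_≤ m) (sym (deg-star-leaf m i)) m≥1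

star-sym : ∀ m u v → star m u v ≡ star m v u
star-sym m zero zero = refl
star-sym m zero (suc v) = refl
star-sym m (suc u) zero = refl
star-sym m (suc u) (suc v) = refl

IsSp-star : ∀ m → 1 ≤ m → IsSp (star m) m
IsSp-star m m≥1 = (star m , (star-sym m , λ u v e → e) , bounds) , least
  where
  bounds : ∀ v → 1 ≤ deg (star m) v × deg (star m) v ≤ m
  bounds zero = subst (λ d → 1 ≤ d × d ≤ m) (sym (deg-star-centre m)) (m≥1 , ≤-refl)
  bounds (suc i) = subst (λ d → 1 ≤ d × d ≤ m) (sym (deg-star-leaf m i)) (≤-refl , m≥1)
  -- every leaf forces its edge to the centre, so the centre keeps degree m
  least : ∀ j → HasSpanning (star m) j → m ≤ j
  least j (H , span@(sym-H , _) , bounds-H) = begin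
    m                                          ≡⟨ ∑-ones m ⟨
    ∑ {m} (λ _ → 1)                            ≡⟨ sum-cong-≗ (λ i → cong 𝟙 (leaf-edge i)) ⟨
    ∑ (λ i → 𝟙 (H zero (suc i)))               ≤⟨ m≤n+m _ _ ⟩
    ∑ (λ u → 𝟙 (H zero u))                     ≡⟨ deg-∑ H zero ⟨
    deg H zero                                 ≤⟨ proj₂ (bounds-H zero) ⟩
    j                                          ∎
    where
    open ≤-Reasoning
    only-centre : ∀ i u → Edge (star m) (suc i) u → u ≡ zero
    only-centre i zero _ = refl
    leaf-edge : ∀ i → H zero (suc i) ≡ true
    leaf-edge i = trans (sym-H zero (suc i)) (forced-edge span (only-centre i) (proj₁ (bounds-H (suc i))))

-- Attaching K_{1,p} at v is the
-- case where link selects exactly v; extending a witness for A by the star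
-- edges is the case of the empty link.

glueAdj : ∀ {n p} (A : Adj n) (link : Fin n → Bool) → Fin n ⊎ Fin p → Fin n ⊎ Fin p → Bool
glueAdj A link (inj₁ a) (inj₁ b) = A a b
glueAdj A link (inj₁ a) (inj₂ zero) = link a
glueAdj A link (inj₂ zero) (inj₁ b) = link b
glueAdj A link (inj₂ zero) (inj₂ (suc _)) = true
glueAdj A link (inj₂ (suc _)) (inj₂ zero) = true
glueAdj A link _ _ = false

glue : ∀ {n} (A : Adj n) (link : Fin n → Bool) (p : ℕ) → Adj (n + p)
glue {n} A link p x y = glueAdj {n} {p} A link (splitAt n x) (splitAt n y)

glueAdj-sym : ∀ {n p} {A : Adj n} {link} → (∀ a b → A a b ≡ A b a) →
  ∀ s t → glueAdj {p = p} A link s t ≡ glueAdj A link t s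
glueAdj-sym sym-A (inj₁ a) (inj₁ b) = sym-A a b
glueAdj-sym sym-A (inj₁ a) (inj₂ zero) = refl
glueAdj-sym sym-A (inj₁ a) (inj₂ (suc k)) = refl
glueAdj-sym sym-A (inj₂ zero) (inj₁ b) = refl
glueAdj-sym sym-A (inj₂ zero) (inj₂ zero) = refl
glueAdj-sym sym-A (inj₂ zero) (inj₂ (suc l)) = refl
glueAdj-sym sym-A (inj₂ (suc k)) (inj₁ b) = refl
glueAdj-sym sym-A (inj₂ (suc k)) (inj₂ zero) = refl
glueAdj-sym sym-A (inj₂ (suc k)) (inj₂ (suc l)) = refl

glueAdj-mono : ∀ {n p} {A B : Adj n} {link link′ : Fin n → Bool} →
  (∀ a b → Edge A a b → Edge B a b) → (∀ a → link a ≡ true → link′ a ≡ true) →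
  ∀ s t → glueAdj {p = p} A link s t ≡ true → glueAdj B link′ s t ≡ true
glueAdj-mono A⊆B link⊆ (inj₁ a) (inj₁ b) e = A⊆B a b e
glueAdj-mono A⊆B link⊆ (inj₁ a) (inj₂ zero) e = link⊆ a e
glueAdj-mono A⊆B link⊆ (inj₂ zero) (inj₁ b) e = link⊆ b e
glueAdj-mono A⊆B link⊆ (inj₂ zero) (inj₂ (suc l)) e = refl
glueAdj-mono A⊆B link⊆ (inj₂ (suc k)) (inj₂ zero) e = refl

attach-glue : ∀ {n} (A : Adj n) v p → Iso (attach A v p) (glue A (λ i → does (i ≟ v)) p)
attach-glue {n} A v p = record
  { to = λ x → x ; from = λ x → x ; to-from = λ _ → refl ; from-to = λ _ → refl
  ; preserve = λ x y → same (splitAt n x) (splitAt n y) }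
  where
  same : ∀ s t → attachAdj {n} {p} A v s t ≡ glueAdj A (λ i → does (i ≟ v)) s t
  same (inj₁ a) (inj₁ b) = refl
  same (inj₁ a) (inj₂ zero) = refl
  same (inj₁ a) (inj₂ (suc k)) = refl
  same (inj₂ zero) (inj₁ b) = refl
  same (inj₂ zero) (inj₂ zero) = refl
  same (inj₂ zero) (inj₂ (suc l)) = refl
  same (inj₂ (suc k)) (inj₁ b) = refl
  same (inj₂ (suc k)) (inj₂ zero) = refl
  same (inj₂ (suc k)) (inj₂ (suc l)) = refl

module Parts (n q : ℕ) where

  old : Fin n → Fin (n + suc q)
  old i = i ↑ˡ suc q

  centre : Fin (n + suc q)
  centre = n ↑ʳ zero

  leaf : Fin q → Fin (n + suc q)
  leaf k = n ↑ʳ suc k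

  data Part : Fin (n + suc q) → Set where
    is-old : ∀ i → Part (old i)
    is-centre : Part centre
    is-leaf : ∀ k → Part (leaf k)

  part : ∀ x → Part x
  part x with splitAt n x in eq
  ... | inj₁ i = subst Part (splitAt⁻¹-↑ˡ eq) (is-old i)
  ... | inj₂ zero = subst Part (splitAt⁻¹-↑ʳ eq) is-centre
  ... | inj₂ (suc k) = subst Part (splitAt⁻¹-↑ʳ eq) (is-leaf k)

  deg-parts : ∀ (K : Adj (n + suc q)) x →
    deg K x ≡ ∑ (λ i → 𝟙 (K x (old i))) + (𝟙 (K x centre) + ∑ (λ k → 𝟙 (K x (leaf k))))
  deg-parts K x = trans (deg-∑ K x) (∑-split n (suc q) (λ u → 𝟙 (K x u)))

module Glue {n : ℕ} (A : Adj n) (link : Fin n → Bool) (q : ℕ) where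
  open Parts n q

  G : Adj (n + suc q)
  G = glue A link (suc q)

  G-join : ∀ s t → G (join n (suc q) s) (join n (suc q) t) ≡ glueAdj A link s t
  G-join s t = cong₂ (glueAdj A link) (splitAt-join n (suc q) s) (splitAt-join n (suc q) t)

  deg-join : ∀ s → deg G (join n (suc q) s) ≡
    ∑ (λ i → 𝟙 (glueAdj A link s (inj₁ i))) +
    (𝟙 (glueAdj A link s (inj₂ zero)) + ∑ (λ k → 𝟙 (glueAdj A link s (inj₂ (suc k)))))
  deg-join s = trans (deg-parts G _) (cong₂ _+_
    (sum-cong-≗ (λ i → cong 𝟙 (G-join s (inj₁ i))))
    (cong₂ _+_ (cong 𝟙 (G-join s (inj₂ zero))) (sum-cong-≗ (λ k → cong 𝟙 (G-join s (inj₂ (suc k)))))))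

  deg-old : ∀ i → deg G (old i) ≡ deg A i + 𝟙 (link i)
  deg-old i = trans (deg-join (inj₁ i))
    (cong₂ _+_ (sym (deg-∑ A i)) (trans (cong (𝟙 (link i) +_) (∑-nothing q)) (+-identityʳ _)))

  deg-centre : deg G centre ≡ ∑ (λ i → 𝟙 (link i)) + q
  deg-centre = trans (deg-join (inj₂ zero)) (cong (∑ (λ i → 𝟙 (link i)) +_) (∑-ones q))

  deg-leaf : ∀ k → deg G (leaf k) ≡ 1
  deg-leaf k = trans (deg-join (inj₂ (suc k))) (cong₂ _+_ (∑-nothing n) (cong suc (∑-nothing q)))

  leaf-only-centre : ∀ k u → Edge G (leaf k) u → u ≡ centre
  leaf-only-centre k u e with part u
  ... | is-old i = ⊥-elim (false≢true (trans (sym (G-join (inj₂ (suc k)) (inj₁ i))) e))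
  ... | is-centre = refl
  ... | is-leaf l = ⊥-elim (false≢true (trans (sym (G-join (inj₂ (suc k)) (inj₂ (suc l)))) e))

  -- Anatomy of a witness H for the glued graph: every leaf forces its edge to
  -- the centre, so the centre has H-degree at least (number of H-edges from
  -- the centre to old vertices) + q; and if there are no such edges, H
  -- restricted to the old vertices is a witness for A.
  module GlueWitness {j} (H : Adj (n + suc q)) (span : IsSpanningSubgraph G H)
                     (bounds-H : ∀ x → 1 ≤ deg H x × deg H x ≤ j) where

    linked : ℕ
    linked = ∑ (λ i → 𝟙 (H centre (old i)))

    leaf-edge : ∀ k → Edge H centre (leaf k)
    leaf-edge k = trans (proj₁ span centre (leaf k))
      (forced-edge span (leaf-only-centre k) (proj₁ (bounds-H (leaf k))))

    centre-bound : linked + q ≤ deg H centre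
    centre-bound = begin
      linked + q                                                    ≡⟨ cong (linked +_) (∑-ones q) ⟨
      linked + ∑ {q} (λ _ → 1)                                      ≡⟨ cong (linked +_) (sum-cong-≗ (λ k → cong 𝟙 (leaf-edge k))) ⟨
      linked + ∑ (λ k → 𝟙 (H centre (leaf k)))                      ≤⟨ +-monoʳ-≤ linked (m≤n+m _ _) ⟩
      linked + (𝟙 (H centre centre) + ∑ (λ k → 𝟙 (H centre (leaf k)))) ≡⟨ deg-parts H centre ⟨
      deg H centre                                                  ∎
      where open ≤-Reasoning

    restrict : linked ≡ 0 → HasSpanning A j
    restrict unlinked = H′ , (sym-H′ , H′⊆A) , λ a → subst (λ d → 1 ≤ d × d ≤ j) (sym (deg-H′ a)) (bounds-H (old a))
      where
      H′ : Adj n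
      H′ a b = H (old a) (old b)
      sym-H′ : ∀ a b → H′ a b ≡ H′ b a
      sym-H′ a b = proj₁ span (old a) (old b)
      H′⊆A : ∀ a b → Edge H′ a b → Edge A a b
      H′⊆A a b e = trans (sym (G-join (inj₁ a) (inj₁ b))) (proj₂ span (old a) (old b) e)
      no-centre : ∀ a → H (old a) centre ≡ false
      no-centre a = trans (proj₁ span (old a) centre) (𝟙≤0 (subst (𝟙 (H centre (old a)) ≤_) unlinked
        (∑-point (λ i → 𝟙 (H centre (old i))) a)))
        where
        𝟙≤0 : ∀ {b} → 𝟙 b ≤ 0 → b ≡ false
        𝟙≤0 {false} _ = refl
      no-leaf : ∀ a k → H (old a) (leaf k) ≡ false
      no-leaf a k = ¬-not (λ e → false≢true (trans (sym (G-join (inj₁ a) (inj₂ (suc k)))) (proj₂ span _ _ e)))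
      deg-H′ : ∀ a → deg H′ a ≡ deg H (old a)
      deg-H′ a = begin
        deg H′ a                                    ≡⟨ deg-∑ H′ a ⟩
        ∑ (λ b → 𝟙 (H′ a b))                        ≡⟨ +-identityʳ _ ⟨
        ∑ (λ b → 𝟙 (H′ a b)) + 0                    ≡⟨ cong (∑ (λ b → 𝟙 (H′ a b)) +_) (cong₂ _+_ (cong 𝟙 (no-centre a))
                                                         (∑-zero _ (λ k → cong 𝟙 (no-leaf a k)))) ⟨
        ∑ (λ b → 𝟙 (H′ a b)) + (𝟙 (H (old a) centre) + ∑ (λ k → 𝟙 (H (old a) (leaf k))))
                                                    ≡⟨ deg-parts H (old a) ⟨
        deg H (old a)                               ∎
        where open ≡-Reasoning

  glue-least : IsSp A (suc q) → ∀ j → HasSpanning G j → suc q ≤ j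
  glue-least (_ , least-A) j (H , span , bounds-H) = by-linked linked refl
    where
    open GlueWitness H span bounds-H
    by-linked : ∀ s → linked ≡ s → suc q ≤ j
    by-linked zero unlinked = least-A j (restrict unlinked)
    by-linked (suc s) e = ≤-trans (s≤s (m≤n+m q s))
      (≤-trans (≤-reflexive (cong (_+ q) (sym e))) (≤-trans centre-bound (proj₂ (bounds-H centre))))

glue-extend : ∀ {n} (A : Adj n) link q j → 1 ≤ q → HasSpanning A j → HasSpanning (glue A link (suc q)) (j ⊔ q)
glue-extend {n} A link q j q≥1 (H , (sym-H , H⊆A) , bounds-H) =
  glue H (λ _ → false) (suc q) ,
  ((λ x y → glueAdj-sym sym-H (splitAt n x) (splitAt n y)) ,
   (λ x y → glueAdj-mono H⊆A (λ _ ()) (splitAt n x) (splitAt n y))) ,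
  bounds
  where
  open Parts n q
  open Glue H (λ _ → false) q using (G; deg-old; deg-centre; deg-leaf)
  bounds : ∀ x → 1 ≤ deg G x × deg G x ≤ j ⊔ q
  bounds x with part x
  ... | is-old i = subst (λ d → 1 ≤ d × d ≤ j ⊔ q) (sym (trans (deg-old i) (+-identityʳ _)))
                     (proj₁ (bounds-H i) , ≤-trans (proj₂ (bounds-H i)) (m≤m⊔n j q))
  ... | is-centre = subst (λ d → 1 ≤ d × d ≤ j ⊔ q) (sym (trans deg-centre (cong (_+ q) (∑-nothing n))))
                      (q≥1 , m≤n⊔m j q)
  ... | is-leaf k = subst (λ d → 1 ≤ d × d ≤ j ⊔ q) (sym (deg-leaf k)) (≤-refl , ≤-trans q≥1 (m≤n⊔m j q))

glue-Δ : ∀ {n} (A : Adj n) v q → Δ A ≡ suc q → deg A v < suc q →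
  Δ (glue A (λ i → does (i ≟ v)) (suc q)) ≡ suc q
glue-Δ {n} A v q Δ-A v-low = ≤-antisym (Δ-lub G (suc q) bound) (subst (_≤ Δ G) deg-c (deg≤Δ G centre))
  where
  open Parts n q
  open Glue A (λ i → does (i ≟ v)) q using (G; deg-old; deg-centre; deg-leaf)
  deg-c : deg G centre ≡ suc q
  deg-c = trans deg-centre (cong (_+ q) (∑-indicator v))
  bound : ∀ x → deg G x ≤ suc q
  bound x with part x
  ... | is-centre = ≤-reflexive deg-c
  ... | is-leaf k = subst (_≤ suc q) (sym (deg-leaf k)) (s≤s z≤n)
  ... | is-old i with i ≟ v
  ...   | yes refl = subst (_≤ suc q) (sym (trans (deg-old v) (trans (cong (λ b → deg A v + 𝟙 b) (does-refl v))
                       (+-comm (deg A v) 1)))) v-low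
  ...   | no i≢v = subst (_≤ suc q) (sym (trans (deg-old i) (trans (cong (λ b → deg A i + 𝟙 b) (does-≢ i≢v))
                       (+-identityʳ _)))) (subst (deg A i ≤_) Δ-A (deg≤Δ A i))

attach-IsSp : ∀ {n} (A : Adj n) v q → 1 ≤ q → IsSp A (suc q) → IsSp (attach A v (suc q)) (suc q)
attach-IsSp {n} A v q q≥1 sp-A = IsSp-iso (attach-glue A v (suc q)) (suc q)
  ( subst (HasSpanning (glue A link (suc q))) (m≥n⇒m⊔n≡m (n≤1+n q)) (glue-extend A link q (suc q) q≥1 (proj₁ sp-A))
  , Glue.glue-least A link q sp-A )
  where
  link : Fin n → Bool
  link i = does (i ≟ v)

attach-Δ : ∀ {n} (A : Adj n) v q → Δ A ≡ suc q → InB A v → Δ (attach A v (suc q)) ≡ suc q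
attach-Δ A v q Δ-A v∈B = trans (Δ-iso (attach-glue A v (suc q))) (glue-Δ A v q Δ-A (subst (deg A v <_) Δ-A v∈B))

Built⇒sp : ∀ {n} {T : Adj n} → Built T → IsSp T (Δ T)
Built⇒sp (base m m≥1 _ I) =
  IsSp-iso I _ (subst (IsSp (star m)) (sym (trans (Δ-iso I) (Δ-star m m≥1))) (IsSp-star m m≥1))
Built⇒sp (grow {A = A} _ _ (suc q) sp-A Δ-A (s≤s q≥1) v v∈B _ I) =
  IsSp-iso I _ (subst (IsSp (attach A v (suc q))) (sym (trans (Δ-iso I) (attach-Δ A v q Δ-A v∈B)))
    (attach-IsSp A v q q≥1 sp-A))

lookup-injective : ∀ {n} (xs : List (Fin n)) → Unique xs → ∀ i j → lookup xs i ≡ lookup xs j → i ≡ j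
lookup-injective (x ∷ xs) _ zero zero _ = refl
lookup-injective (x ∷ xs) (x∉xs ∷ _) zero (suc j) e = ⊥-elim (All.lookup x∉xs (∈-lookup j) e)
lookup-injective (x ∷ xs) (x∉xs ∷ _) (suc i) zero e = ⊥-elim (All.lookup x∉xs (∈-lookup i) (sym e))
lookup-injective (x ∷ xs) (_ ∷ u) (suc i) (suc j) e = cong suc (lookup-injective xs u i j e)

module Induced {n : ℕ} (T : Adj n) (kept : Fin n → Bool) where

  private
    kept? : ∀ u → Dec (kept u ≡ true)
    kept? u = kept u Bool.≟ true
    members : List (Fin n)
    members = filter kept? (allFin n)
    member : ∀ y → kept y ≡ true → y ∈ members
    member y k = ∈-filter⁺ kept? (∈-allFin y) k

  m : ℕ
  m = length members

  vertex : Fin m → Fin n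
  vertex = lookup members

  vertex-injective : ∀ {i j} → vertex i ≡ vertex j → i ≡ j
  vertex-injective {i} {j} = lookup-injective members (Unique.filter⁺ kept? (Unique.allFin⁺ n)) i j

  vertex-kept : ∀ i → kept (vertex i) ≡ true
  vertex-kept i = proj₂ (∈-filter⁻ kept? {xs = allFin n} (∈-lookup i))

  index : ∀ y → kept y ≡ true → Fin m
  index y k = Any.index (member y k)

  vertex-index : ∀ y k → vertex (index y k) ≡ y
  vertex-index y k = sym (lookup-index (member y k))

  index-vertex : ∀ i k → index (vertex i) k ≡ i
  index-vertex i k = vertex-injective (vertex-index (vertex i) k)

  index-cong : ∀ {y y′} k k′ → y ≡ y′ → index y k ≡ index y′ k′
  index-cong {y} {y′} k k′ y≡y′ = vertex-injective (trans (vertex-index y k) (trans y≡y′ (sym (vertex-index y′ k′))))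

  T′ : Adj m
  T′ a b = T (vertex a) (vertex b)

  simple′ : IsSimple T → IsSimple T′
  simple′ (sym-T , loopless) = (λ a b → sym-T (vertex a) (vertex b)) , (λ a → loopless (vertex a))

  acyclic′ : Acyclic T → Acyclic T′
  acyclic′ acyclic (x , xs , long , unique , linked) = acyclic (vertex x , map vertex xs ,
    subst (3 ≤_) (sym (length-map vertex (x ∷ xs))) long ,
    Unique.map⁺ vertex-injective unique ,
    subst (Linked (Edge T)) (map-++ vertex (x ∷ xs) (x ∷ []))
      (Linked.map⁺ {R = Edge T} {f = vertex} linked))

  -- If a retraction π onto the kept vertices sends every edge to an edge or
  -- collapses it, then walks of T project to walks of T′, so T′ is connected
  -- whenever T is; in particular T′ is then a tree whenever T is.
  module Retraction (π : Fin n → Fin n) (π-kept : ∀ y → kept (π y) ≡ true)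
                    (π-id : ∀ y → kept y ≡ true → π y ≡ y)
                    (π-edge : ∀ x y → Edge T x y → π x ≡ π y ⊎ Edge T (π x) (π y)) where

    project : Fin n → Fin m
    project y = index (π y) (π-kept y)

    project-walk : ∀ {x y} → Walk T x y → Walk T′ (project x) (project y)
    project-walk here = here
    project-walk (step {u} {w} e walk) with π-edge u w e
    ... | inj₁ πu≡πw = subst (λ z → Walk T′ z _) (index-cong (π-kept w) (π-kept u) (sym πu≡πw)) (project-walk walk)
    ... | inj₂ e′ = step (subst₂ (Edge T) (sym (vertex-index _ (π-kept u))) (sym (vertex-index _ (π-kept w))) e′)
                         (project-walk walk)

    project-vertex : ∀ a → project (vertex a) ≡ a
    project-vertex a = vertex-injective (trans (vertex-index _ (π-kept (vertex a))) (π-id (vertex a) (vertex-kept a)))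

    tree′ : IsTree T → IsTree T′
    tree′ (simple , connected , acyclic) = simple′ simple ,
      (λ a b → subst₂ (Walk T′) (project-vertex a) (project-vertex b) (project-walk (connected (vertex a) (vertex b)))) ,
      acyclic′ acyclic

connected-deg≥1 : ∀ {n} (A : Adj n) → 2 ≤ n → Connected A → ∀ v → 1 ≤ deg A v
connected-deg≥1 {suc zero} A (s≤s ()) connected v
connected-deg≥1 {suc (suc n)} A _ connected v = first-step (connected v (other v)) (other-≢ v)
  where
  other : Fin (suc (suc n)) → Fin (suc (suc n))
  other zero = suc zero
  other (suc _) = zero
  other-≢ : ∀ v → ¬ v ≡ other v
  other-≢ zero ()
  other-≢ (suc _) ()
  first-step : ∀ {x y} → Walk A x y → ¬ x ≡ y → 1 ≤ deg A x
  first-step here x≢y = ⊥-elim (x≢y refl)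
  first-step (step e _) _ = edge⇒deg≥1 A _ _ e

leaf-neighbour : ∀ {n} (A : Adj n) x → deg A x ≤ 1 → 1 ≤ deg A x →
  ∃ λ y → Edge A x y × (∀ z → Edge A x z → z ≡ y)
leaf-neighbour A x d≤1 d≥1 with deg≥1⇒edge A x d≥1
... | y , e = y , e , λ z e′ → deg≤1-unique A x d≤1 e′ e

Unique-prefix : ∀ {n} (as : List (Fin n)) {b cs} → Unique (as ++ b ∷ cs) → Unique (as ++ b ∷ [])
Unique-prefix [] (_ ∷ _) = All.[] ∷ []
Unique-prefix (a ∷ as) (a∉ ∷ u) =
  All.++⁺ (All.++⁻ˡ as a∉) (All.head (All.++⁻ʳ as a∉) All.∷ All.[]) ∷ Unique-prefix as u

Linked-close : ∀ {n} {R : Fin n → Fin n → Set} (as : List (Fin n)) {b cs x} →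
  Linked R (as ++ b ∷ cs) → R b x → Linked R (as ++ b ∷ x ∷ [])
Linked-close [] _ r = r ∷ [-]
Linked-close (a ∷ []) (r′ ∷ l) r = r′ ∷ Linked-close [] l r
Linked-close (a ∷ a′ ∷ as) (r′ ∷ l) r = r′ ∷ Linked-close (a′ ∷ as) l r

module _ {n : ℕ} {T : Adj n} (simple : IsSimple T) (acyclic : Acyclic T) where

  -- If every neighbour of the end x of a path x ∷ xs lies on the path, then x
  -- has degree ≤ 1: a neighbour beyond the second vertex would close a cycle.
  path-end : ∀ x xs → Unique (x ∷ xs) → Linked (Edge T) (x ∷ xs) →
    (∀ z → Edge T x z → z ∈ x ∷ xs) → deg T x ≤ 1
  path-end x [] _ _ on-path = unique⇒deg≤1 T x x only
    where
    only : ∀ z → Edge T x z → z ≡ x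
    only z e with on-path z e
    ... | Any.here z≡x = z≡x
  path-end x (w ∷ ws) unique linked on-path = unique⇒deg≤1 T x w only
    where
    only : ∀ z → Edge T x z → z ≡ w
    only z e with on-path z e
    ... | Any.here refl = ⊥-elim (false≢true (trans (sym (proj₂ simple x)) e))
    ... | Any.there (Any.here z≡w) = z≡w
    ... | Any.there (Any.there z∈ws) with ∈-∃++ z∈ws
    ...   | ys , zs , refl = ⊥-elim (acyclic (x , w ∷ ys ++ z ∷ [] , long , Unique-prefix (x ∷ w ∷ ys) unique , closed))
      where
      long : 3 ≤ length (x ∷ w ∷ ys ++ z ∷ [])
      long = s≤s (s≤s (≤-trans (m≤n+m 1 (length ys)) (≤-reflexive (sym (length-++ ys)))))
      closed : Linked (Edge T) ((x ∷ w ∷ ys ++ z ∷ []) ∷ʳ x)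
      closed = subst (Linked (Edge T)) (cong (λ t → x ∷ w ∷ t) (sym (++-assoc ys (z ∷ []) (x ∷ []))))
                 (Linked-close (x ∷ w ∷ ys) linked (trans (proj₁ simple z x) e))

  -- Extend a path at its end while possible; since a path has at most n
  -- vertices this stops, at a vertex of degree ≤ 1.
  extend-path : ∀ k x xs → Unique (x ∷ xs) → Linked (Edge T) (x ∷ xs) →
    n ≤ length (x ∷ xs) + k → ∃ λ y → deg T y ≤ 1
  extend-path k x xs unique linked room
    with any? (λ z → (T x z Bool.≟ true) ×-dec ¬? (DecMembership._∈?_ _≟_ z (x ∷ xs)))
  ... | no stuck = x , path-end x xs unique linked on-path
    where
    on-path : ∀ z → Edge T x z → z ∈ x ∷ xs
    on-path z e with DecMembership._∈?_ _≟_ z (x ∷ xs)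
    ... | yes z∈ = z∈
    ... | no z∉ = ⊥-elim (stuck (z , e , z∉))
  ... | yes (z , e , z∉) with k
  ...   | zero = ⊥-elim (1+n≰n (≤-trans too-long (≤-trans room (≤-reflexive (+-identityʳ _)))))
    where
    too-long : length (z ∷ x ∷ xs) ≤ n
    too-long = injective⇒≤ (λ {i} {j} → lookup-injective (z ∷ x ∷ xs) (All.¬Any⇒All¬ (x ∷ xs) z∉ ∷ unique) i j)
  ...   | suc k′ = extend-path k′ z (x ∷ xs) (All.¬Any⇒All¬ (x ∷ xs) z∉ ∷ unique)
                    (trans (proj₁ simple z x) e ∷ linked) (≤-trans room (≤-reflexive (+-suc _ k′)))

  low-degree-vertex : 1 ≤ n → ∃ λ y → deg T y ≤ 1
  low-degree-vertex (s≤s _) = extend-path n zero [] (All.[] ∷ []) [-] (n≤1+n n)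

-- Deleting a leaf x with neighbour y: the retraction x ↦ y shows that the
-- remaining graph is again a tree, on fewer vertices.
module LeafDeletion {n : ℕ} (T : Adj n) (tree : IsTree T) (x y : Fin n)
                    (x~y : Edge T x y) (only-y : ∀ z → Edge T x z → z ≡ y) where

  kept : Fin n → Bool
  kept u = not (does (u ≟ x))

  open Induced T kept public

  kept-≢ : ∀ {u} → ¬ u ≡ x → kept u ≡ true
  kept-≢ u≢x = cong not (does-≢ u≢x)

  kept⇒≢ : ∀ {u} → kept u ≡ true → ¬ u ≡ x
  kept⇒≢ k refl = false≢true (trans (sym (cong not (does-refl x))) k)

  private
    sym-T : ∀ u w → T u w ≡ T w u
    sym-T = proj₁ (proj₁ tree)
    loopless : ∀ u → T u u ≡ false
    loopless = proj₂ (proj₁ tree)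

  y≢x : ¬ y ≡ x
  y≢x refl = false≢true (trans (sym (loopless x)) x~y)

  π : Fin n → Fin n
  π u with u ≟ x
  ... | yes _ = y
  ... | no _ = u

  π-kept : ∀ u → kept (π u) ≡ true
  π-kept u with u ≟ x
  ... | yes _ = kept-≢ y≢x
  ... | no u≢x = kept-≢ u≢x

  π-id : ∀ u → kept u ≡ true → π u ≡ u
  π-id u k with u ≟ x
  ... | yes _ = ⊥-elim (false≢true k)
  ... | no _ = refl

  π-edge : ∀ a b → Edge T a b → π a ≡ π b ⊎ Edge T (π a) (π b)
  π-edge a b e with a ≟ x | b ≟ x
  ... | yes refl | yes refl = ⊥-elim (false≢true (trans (sym (loopless x)) e))
  ... | yes refl | no _ = inj₁ (sym (only-y b e))
  ... | no _ | yes refl = inj₁ (only-y a (trans (sym-T x a) e))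
  ... | no _ | no _ = inj₂ e

  open Retraction π π-kept π-id π-edge using (tree′)

  tree-T′ : IsTree T′
  tree-T′ = tree′ tree

  smaller : m < n
  smaller = injective⇒≤ {f = with-x} with-x-injective
    where
    with-x : Fin (suc m) → Fin n
    with-x zero = x
    with-x (suc i) = vertex i
    with-x-injective : ∀ {i j} → with-x i ≡ with-x j → i ≡ j
    with-x-injective {zero} {zero} _ = refl
    with-x-injective {zero} {suc j} e = ⊥-elim (kept⇒≢ (vertex-kept j) (sym e))
    with-x-injective {suc i} {zero} e = ⊥-elim (kept⇒≢ (vertex-kept i) e)
    with-x-injective {suc i} {suc j} e = cong suc (vertex-injective e)

Rooting : ∀ {n} → Adj n → (Fin n → Fin n) → Set
Rooting T parent = ∀ u w → Edge T u w → parent u ≡ w ⊎ parent w ≡ u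

-- Every tree has a rooting: root the tree obtained by deleting a leaf x, and
-- make x a child of its neighbour.
rooting : ∀ {n} (T : Adj n) → IsTree T → Σ (Fin n → Fin n) (Rooting T)
rooting {n} = <-rec (λ n → (T : Adj n) → IsTree T → Σ (Fin n → Fin n) (Rooting T)) root n
  where
  root : ∀ n → (∀ {m} → m < n → (T : Adj m) → IsTree T → Σ (Fin m → Fin m) (Rooting T)) →
         (T : Adj n) → IsTree T → Σ (Fin n → Fin n) (Rooting T)
  root zero _ T _ = (λ u → u) , λ ()
  root (suc zero) _ T ((_ , loopless) , _) = (λ u → u) , λ { zero zero e → ⊥-elim (false≢true (trans (sym (loopless zero)) e)) }
  root (suc (suc n)) rec T tree@(simple@(sym-T , _) , connected , acyclic)
    with low-degree-vertex simple acyclic (s≤s z≤n)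
  ... | x , x-low with leaf-neighbour T x x-low (connected-deg≥1 T (s≤s (s≤s z≤n)) connected x)
  ... | y , x~y , only-y = parent , rooted
    where
    open LeafDeletion T tree x y x~y only-y
    parent′ : Fin m → Fin m
    parent′ = proj₁ (rec smaller T′ tree-T′)
    rooted′ : Rooting T′ parent′
    rooted′ = proj₂ (rec smaller T′ tree-T′)
    parent : Fin (suc (suc n)) → Fin (suc (suc n))
    parent u with u ≟ x
    ... | yes _ = y
    ... | no u≢x = vertex (parent′ (index u (kept-≢ u≢x)))
    rooted : Rooting T parent
    rooted a b e with a ≟ x | b ≟ x
    ... | yes refl | yes refl = ⊥-elim (false≢true (trans (sym (proj₂ simple x)) e))
    ... | yes refl | no _ = inj₁ (sym (only-y b e))
    ... | no _ | yes refl = inj₂ (sym (only-y a (trans (sym-T x a) e)))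
    ... | no a≢x | no b≢x with rooted′ (index a (kept-≢ a≢x)) (index b (kept-≢ b≢x))
                                 (subst₂ (Edge T) (sym (vertex-index a _)) (sym (vertex-index b _)) e)
    ...   | inj₁ pa≡b = inj₁ (trans (cong vertex pa≡b) (vertex-index b _))
    ...   | inj₂ pb≡a = inj₂ (trans (cong vertex pb≡a) (vertex-index a _))

isLeaf : ∀ {n} → Adj n → Fin n → Bool
isLeaf T u = does (deg T u Nat.≟ 1)

ℓ : ∀ {n} → Adj n → Fin n → ℕ
ℓ T w = ∑ (λ u → 𝟙 (T w u ∧ isLeaf T u))

leaf-deg : ∀ {n} (T : Adj n) u → isLeaf T u ≡ true → deg T u ≡ 1
leaf-deg T u = does-true (deg T u Nat.≟ 1)

leaf-intro : ∀ {n} (T : Adj n) u → deg T u ≡ 1 → isLeaf T u ≡ true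
leaf-intro T u = dec-true (deg T u Nat.≟ 1)

non-leaf-deg : ∀ {n} (T : Adj n) u → 1 ≤ deg T u → isLeaf T u ≡ false → 2 ≤ deg T u
non-leaf-deg T u d≥1 non-leaf =
  ≤∧≢⇒< d≥1 (λ 1≡d → false≢true (trans (sym non-leaf) (leaf-intro T u (sym 1≡d))))

-- Root T and let a non-leaf vertex w be "bare"
-- when it has no leaf neighbour; a bare w picks a child c(w).  Keep the edges
-- at leaves and the edges w c(w).  A non-leaf w then keeps its ℓ(w) leaf
-- edges, the edge to c(w) if w is bare (then ℓ(w) = 0), and at most one edge
-- w u with c(u) = w, namely to its parent.  So its degree is at most
-- max(2, ℓ(w) + 1), while every vertex keeps at least one edge.
module KeySubgraph {n : ℕ} (T : Adj n) (tree : IsTree T) (n≥2 : 2 ≤ n) where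

  private
    sym-T : ∀ u w → T u w ≡ T w u
    sym-T = proj₁ (proj₁ tree)
    parent : Fin n → Fin n
    parent = proj₁ (rooting T tree)
    rooted : Rooting T parent
    rooted = proj₂ (rooting T tree)
    deg≥1 : ∀ u → 1 ≤ deg T u
    deg≥1 = connected-deg≥1 T n≥2 (proj₁ (proj₂ tree))

  leaf : Fin n → Bool
  leaf = isLeaf T

  bare : Fin n → Bool
  bare w = does (ℓ T w Nat.≟ 0)

  child : Fin n → Fin n
  child w with any? (λ u → (T w u Bool.≟ true) ×-dec ¬? (u ≟ parent w))
  ... | yes (u , _) = u
  ... | no _ = w

  child-spec : ∀ w → 2 ≤ deg T w → Edge T w (child w) × ¬ child w ≡ parent w
  child-spec w d≥2 with any? (λ u → (T w u Bool.≟ true) ×-dec ¬? (u ≟ parent w))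
  ... | yes (u , spec) = spec
  ... | no none = ⊥-elim (1+n≰n (≤-trans d≥2 (unique⇒deg≤1 T w (parent w) only-parent)))
    where
    only-parent : ∀ z → Edge T w z → z ≡ parent w
    only-parent z e with z ≟ parent w
    ... | yes z≡p = z≡p
    ... | no z≢p = ⊥-elim (none (z , e , z≢p))

  chooses : Fin n → Fin n → Bool
  chooses w u = bare w ∧ does (u ≟ child w)

  H : Adj n
  H w u = T w u ∧ (leaf u ∨ leaf w ∨ chooses w u ∨ chooses u w)

  H-sym : ∀ w u → H w u ≡ H u w
  H-sym w u = cong₂ _∧_ (sym-T w u) (swap (leaf u) (leaf w) (chooses w u) (chooses u w))
    where
    swap : ∀ a b c d → (a ∨ b ∨ c ∨ d) ≡ (b ∨ a ∨ d ∨ c)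
    swap a b c d = trans (sym (∨-assoc a b _)) (trans (cong₂ _∨_ (∨-comm a b) (∨-comm c d)) (∨-assoc b a _))

  H⊆T : ∀ w u → Edge H w u → Edge T w u
  H⊆T w u e = proj₁ (∧-true e)

  reason : ∀ w u → leaf w ≡ false → Edge H w u →
    (T w u ∧ leaf u) ≡ true ⊎ chooses w u ≡ true ⊎ u ≡ parent w
  reason w u non-leaf e with ∧-true {T w u} e
  ... | t , why with ∨-true why
  ...   | inj₁ leaf-u = inj₁ (cong₂ _∧_ t leaf-u)
  ...   | inj₂ why′ with ∨-true why′
  ...     | inj₁ leaf-w = ⊥-elim (false≢true (trans (sym non-leaf) leaf-w))
  ...     | inj₂ why″ with ∨-true why″
  ...       | inj₁ w-chooses = inj₂ (inj₁ w-chooses)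
  ...       | inj₂ u-chooses with leaf u in leaf-u
  ...         | true = inj₁ (cong (_∧ true) t)
  -- c(u) = w is not the parent of u, so the edge makes u the parent of w
  ...         | false with rooted u w (trans (sym-T u w) t) | child-spec u (non-leaf-deg T u (deg≥1 u) leaf-u)
  ...           | inj₁ pu≡w | _ , c≢p =
                    ⊥-elim (c≢p (trans (sym (does-true (w ≟ child u) (proj₂ (∧-true {bare u} u-chooses)))) (sym pu≡w)))
  ...           | inj₂ pw≡u | _ = inj₂ (inj₂ (sym pw≡u))

  ∑-chooses : ∀ w → ∑ (λ u → 𝟙 (chooses w u)) ≤ 𝟙 (bare w)
  ∑-chooses w with bare w
  ... | true = ≤-reflexive (∑-indicator (child w))
  ... | false = ≤-reflexive (∑-zero {n} (λ _ → 0) (λ _ → refl))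

  deg-non-leaf : ∀ w → leaf w ≡ false → deg H w ≤ ℓ T w + (𝟙 (bare w) + 1)
  deg-non-leaf w non-leaf = begin
    deg H w                                                  ≡⟨ deg-∑ H w ⟩
    ∑ (λ u → 𝟙 (H w u))                                      ≤⟨ ∑-mono by-reason ⟩
    ∑ (λ u → 𝟙 (T w u ∧ leaf u) + (𝟙 (chooses w u) + 𝟙 (does (u ≟ parent w))))
                                                             ≡⟨ ∑-distrib-+ (λ u → 𝟙 (T w u ∧ leaf u)) _ ⟩
    ℓ T w + ∑ (λ u → 𝟙 (chooses w u) + 𝟙 (does (u ≟ parent w)))
                                                             ≡⟨ cong (ℓ T w +_) (∑-distrib-+ (λ u → 𝟙 (chooses w u)) _) ⟩
    ℓ T w + (∑ (λ u → 𝟙 (chooses w u)) + ∑ (λ u → 𝟙 (does (u ≟ parent w))))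
                                                             ≤⟨ +-monoʳ-≤ (ℓ T w) (+-mono-≤ (∑-chooses w)
                                                                  (≤-reflexive (∑-indicator (parent w)))) ⟩
    ℓ T w + (𝟙 (bare w) + 1)                                 ∎
    where
    open ≤-Reasoning
    by-reason : ∀ u → 𝟙 (H w u) ≤ 𝟙 (T w u ∧ leaf u) + (𝟙 (chooses w u) + 𝟙 (does (u ≟ parent w)))
    by-reason u = 𝟙-bound λ e → by (reason w u non-leaf e)
      where
      a b c : ℕ
      a = 𝟙 (T w u ∧ leaf u)
      b = 𝟙 (chooses w u)
      c = 𝟙 (does (u ≟ parent w))
      by : (T w u ∧ leaf u) ≡ true ⊎ chooses w u ≡ true ⊎ u ≡ parent w → 1 ≤ a + (b + c)
      by (inj₁ r) = ≤-trans (𝟙-true r) (m≤m+n a (b + c))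
      by (inj₂ (inj₁ r)) = ≤-trans (𝟙-true r) (≤-trans (m≤m+n b c) (m≤n+m (b + c) a))
      by (inj₂ (inj₂ u≡p)) = ≤-trans (𝟙-true (dec-true (u ≟ parent w) u≡p)) (≤-trans (m≤n+m c b) (m≤n+m (b + c) a))

  H-at-leaf : ∀ w u → Edge T w u → leaf w ≡ true → Edge H w u
  H-at-leaf w u t leaf-w rewrite t | leaf-w = ∨-zeroʳ (leaf u)

  H-to-leaf : ∀ w u → Edge T w u → leaf u ≡ true → Edge H w u
  H-to-leaf w u t leaf-u rewrite t | leaf-u = refl

  H-to-child : ∀ w → Edge T w (child w) → bare w ≡ true → Edge H w (child w)
  H-to-child w t bare-w rewrite t | bare-w | does-refl (child w) =
    trans (cong (leaf (child w) ∨_) (∨-zeroʳ (leaf w))) (∨-zeroʳ (leaf (child w)))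

  H-deg≥1 : ∀ w → 1 ≤ deg H w
  H-deg≥1 w = by-cases (leaf w) at-leaf (λ non-leaf → by-cases (bare w) (at-bare non-leaf) at-supported)
    where
    at-leaf : leaf w ≡ true → 1 ≤ deg H w
    at-leaf leaf-w with deg≥1⇒edge T w (deg≥1 w)
    ... | y , t = edge⇒deg≥1 H w y (H-at-leaf w y t leaf-w)
    at-bare : leaf w ≡ false → bare w ≡ true → 1 ≤ deg H w
    at-bare non-leaf bare-w = edge⇒deg≥1 H w (child w)
      (H-to-child w (proj₁ (child-spec w (non-leaf-deg T w (deg≥1 w) non-leaf))) bare-w)
    at-supported : bare w ≡ false → 1 ≤ deg H w
    at-supported supported with ∑-pos (λ u → 𝟙 (T w u ∧ leaf u)) (n≢0⇒n>0 (does-false (ℓ T w Nat.≟ 0) supported))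
    ... | u , leaf-edge with ∧-true {T w u} (𝟙-true⁻¹ leaf-edge)
    ...   | t , leaf-u = edge⇒deg≥1 H w u (H-to-leaf w u t leaf-u)

key-spanning : ∀ {n} (T : Adj n) → IsTree T → 2 ≤ n → ∀ E → 2 ≤ E → (∀ w → ℓ T w + 1 ≤ E) → HasSpanning T E
key-spanning T tree n≥2 E E≥2 ℓ-bound = H , (H-sym , H⊆T) , λ w → H-deg≥1 w , H-deg≤E w
  where
  open KeySubgraph T tree n≥2
  H-deg≤E : ∀ w → deg H w ≤ E
  H-deg≤E w = by-cases (leaf w) at-leaf (λ non-leaf → by-cases (bare w) (at-bare non-leaf) (at-supported non-leaf))
    where
    at-leaf : leaf w ≡ true → deg H w ≤ E
    at-leaf leaf-w = ≤-trans (deg-mono H T w (H⊆T w)) (≤-trans (≤-reflexive (leaf-deg T w leaf-w)) (≤-trans (s≤s z≤n) E≥2))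
    at-bare : leaf w ≡ false → bare w ≡ true → deg H w ≤ E
    at-bare non-leaf bare-w = ≤-trans (deg-non-leaf w non-leaf)
      (≤-trans (≤-reflexive (cong₂ (λ l b → l + (𝟙 b + 1)) (does-true (ℓ T w Nat.≟ 0) bare-w) bare-w)) E≥2)
    at-supported : leaf w ≡ false → bare w ≡ false → deg H w ≤ E
    at-supported non-leaf supported = ≤-trans (deg-non-leaf w non-leaf)
      (subst (λ b → ℓ T w + (𝟙 b + 1) ≤ E) (sym supported) (ℓ-bound w))

ν : ∀ {n} → Adj n → Fin n → ℕ
ν T w = ∑ (λ u → 𝟙 (T w u ∧ not (isLeaf T u)))

deg-leaves : ∀ {n} (T : Adj n) w → deg T w ≡ ℓ T w + ν T w
deg-leaves T w = trans (deg-∑ T w) (trans (sum-cong-≗ (λ u → split (T w u) (isLeaf T u)))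
  (∑-distrib-+ (λ u → 𝟙 (T w u ∧ isLeaf T u)) _))
  where
  split : ∀ a b → 𝟙 a ≡ 𝟙 (a ∧ b) + 𝟙 (a ∧ not b)
  split true true = refl
  split true false = refl
  split false _ = refl

non-leaf-term : ∀ {n} (T : Adj n) w u → Edge T w u → isLeaf T u ≡ false → 1 ≤ 𝟙 (T w u ∧ not (isLeaf T u))
non-leaf-term T w u t non-leaf rewrite t | non-leaf = ≤-refl

only-leaf-neighbours : ∀ {n} (T : Adj n) w → deg T w ≤ ℓ T w → ∀ u → Edge T w u → deg T u ≡ 1
only-leaf-neighbours T w d≤ℓ u t = by-cases (isLeaf T u) (leaf-deg T u) λ non-leaf →
  ⊥-elim (1+n≰n (≤-trans (non-leaf-term T w u t non-leaf) (≤-trans (∑-point _ u) ν≤0)))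
  where
  ν≤0 : ν T w ≤ 0
  ν≤0 = +-cancelˡ-≤ (ℓ T w) (ν T w) 0
    (subst₂ _≤_ (deg-leaves T w) (sym (+-identityʳ (ℓ T w))) d≤ℓ)

one-non-leaf-neighbour : ∀ {n} (T : Adj n) w → deg T w ≤ suc (ℓ T w) → ∀ {u v} →
  Edge T w u → isLeaf T u ≡ false → Edge T w v → isLeaf T v ≡ false → u ≡ v
one-non-leaf-neighbour T w d≤ℓ+1 {u} {v} tu nu tv nv with u ≟ v
... | yes u≡v = u≡v
... | no u≢v = ⊥-elim (1+n≰n (+-cancelˡ-≤ (ℓ T w) 2 1 (begin
  ℓ T w + 2                                                   ≤⟨ +-monoʳ-≤ (ℓ T w) (≤-trans
                                                                  (+-mono-≤ (non-leaf-term T w u tu nu) (non-leaf-term T w v tv nv))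
                                                                  (∑-two _ u v u≢v)) ⟩
  ℓ T w + ν T w                                               ≡⟨ deg-leaves T w ⟨
  deg T w                                                     ≤⟨ d≤ℓ+1 ⟩
  suc (ℓ T w)                                                 ≡⟨ +-comm 1 (ℓ T w) ⟩
  ℓ T w + 1                                                   ∎)))
  where open ≤-Reasoning

-- If every neighbour of c is a leaf, then every vertex of the tree is c or
-- a neighbour of c (along a walk from c, a leaf neighbour of c can only step
-- back to c) ...
star-around : ∀ {n} (T : Adj n) → IsTree T → ∀ c → (∀ u → Edge T c u → deg T u ≡ 1) →
  ∀ z → z ≡ c ⊎ Edge T c z
star-around T ((sym-T , _) , connected , _) c leaves z = go (inj₁ refl) (connected c z)
  where
  go : ∀ {a} → a ≡ c ⊎ Edge T c a → Walk T a z → z ≡ c ⊎ Edge T c z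
  go at here = at
  go (inj₁ refl) (step e walk) = go (inj₂ e) walk
  go {a} (inj₂ c~a) (step e walk) =
    go (inj₁ (deg≤1-unique T a (≤-reflexive (leaves a c~a)) e (trans (sym-T a c) c~a))) walk

star-Δ : ∀ {n} (T : Adj n) → IsTree T → ∀ c → (∀ u → Edge T c u → deg T u ≡ 1) →
  ∀ k → deg T c ≤ k → 1 ≤ k → Δ T ≤ k
star-Δ T tree c leaves k c≤k 1≤k = Δ-lub T k bound
  where
  bound : ∀ z → deg T z ≤ k
  bound z with star-around T tree c leaves z
  ... | inj₁ refl = c≤k
  ... | inj₂ c~z = ≤-trans (≤-reflexive (leaves z c~z)) 1≤k

Good : ∀ {n} → Adj n → Fin n → Set
Good T c = deg T c ≡ Δ T × Δ T ≤ suc (ℓ T c)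

-- For Δ = 1 every vertex is
-- good; for Δ = 2 the neighbour of a leaf is good (unless T = K₂, which has
-- Δ = 1); for Δ = E + 1 ≥ 3 the key lemma with sp(T) > E gives w with
-- ℓ(w) ≥ E, and w is good unless d(w) ≤ E ≤ ℓ(w), in which case T is a star
-- around w with Δ ≤ E.
good-vertex : ∀ {n} (T : Adj n) → IsTree T → 2 ≤ n → IsSp T (Δ T) → ∃ (Good T)
good-vertex {n} T tree@(simple , connected , acyclic) n≥2 (_ , least) = by-Δ (Δ T) refl
  where
  deg≥1 : ∀ u → 1 ≤ deg T u
  deg≥1 = connected-deg≥1 T n≥2 connected
  leafy : ∃ λ x → deg T x ≤ 1
  leafy = low-degree-vertex simple acyclic (≤-trans (s≤s z≤n) n≥2)
  some : Fin n
  some = proj₁ leafy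

  Δ-two : Δ T ≡ 2 → ∃ (Good T)
  Δ-two Δ≡2 with leaf-neighbour T (proj₁ leafy) (proj₂ leafy) (deg≥1 (proj₁ leafy))
  ... | y , x~y , only-y with deg T y Nat.≟ 2
  ...   | yes y-deg = y , trans y-deg (sym Δ≡2) , subst (_≤ suc (ℓ T y)) (sym Δ≡2) (s≤s leaf-x)
    where
    x : Fin n
    x = proj₁ leafy
    leaf-x : 1 ≤ ℓ T y
    leaf-x = ≤-trans (𝟙-true (cong₂ _∧_ (trans (proj₁ simple y x) x~y)
                       (leaf-intro T x (≤-antisym (proj₂ leafy) (deg≥1 x)))))
               (∑-point (λ u → 𝟙 (T y u ∧ isLeaf T u)) x)
  ...   | no y-deg≢2 = ⊥-elim (1+n≰n (≤-trans (≤-reflexive (sym Δ≡2))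
                          (star-Δ T tree (proj₁ leafy) leaf-y 1 (proj₂ leafy) ≤-refl)))
    where
    y-leaf : deg T y ≡ 1
    y-leaf = ≤-antisym (≤-pred (≤∧≢⇒< (≤-trans (deg≤Δ T y) (≤-reflexive Δ≡2)) y-deg≢2)) (deg≥1 y)
    leaf-y : ∀ u → Edge T (proj₁ leafy) u → deg T u ≡ 1
    leaf-y u e = subst (λ z → deg T z ≡ 1) (sym (only-y u e)) y-leaf

  Δ-large : ∀ E → 2 ≤ E → Δ T ≡ suc E → ∃ (Good T)
  Δ-large E E≥2 Δ≡E+1 with any? (λ w → ¬? (ℓ T w + 1 Nat.≤? E))
  ... | no none = ⊥-elim (1+n≰n (≤-trans (≤-reflexive (sym Δ≡E+1))
                    (least E (key-spanning T tree n≥2 E E≥2 bounded))))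
    where
    bounded : ∀ w → ℓ T w + 1 ≤ E
    bounded w with ℓ T w + 1 Nat.≤? E
    ... | yes ok = ok
    ... | no big = ⊥-elim (none (w , big))
  ... | yes (w , big) with deg T w Nat.≟ Δ T
  ...   | yes w-max = w , w-max , subst (_≤ suc (ℓ T w)) (sym Δ≡E+1) (s≤s E≤ℓ)
    where
    E≤ℓ : E ≤ ℓ T w
    E≤ℓ = ≤-pred (subst (E <_) (+-comm (ℓ T w) 1) (≰⇒> big))
  ...   | no w-small = ⊥-elim (1+n≰n (≤-trans (≤-reflexive (sym Δ≡E+1))
                         (star-Δ T tree w (only-leaf-neighbours T w (≤-trans w≤E E≤ℓ)) E w≤E (≤-trans (s≤s z≤n) E≥2))))
    where
    E≤ℓ : E ≤ ℓ T w
    E≤ℓ = ≤-pred (subst (E <_) (+-comm (ℓ T w) 1) (≰⇒> big))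
    w≤E : deg T w ≤ E
    w≤E = ≤-pred (subst (deg T w <_) Δ≡E+1 (≤∧≢⇒< (deg≤Δ T w) w-small))

  by-Δ : ∀ D → Δ T ≡ D → ∃ (Good T)
  by-Δ zero Δ≡0 = ⊥-elim (1+n≰n (≤-trans (deg≥1 some) (≤-trans (deg≤Δ T some) (≤-reflexive Δ≡0))))
  by-Δ (suc zero) Δ≡1 = some ,
    trans (≤-antisym (≤-trans (deg≤Δ T some) (≤-reflexive Δ≡1)) (deg≥1 some)) (sym Δ≡1) ,
    subst (_≤ suc (ℓ T some)) (sym Δ≡1) (s≤s z≤n)
  by-Δ (suc (suc zero)) Δ≡2 = Δ-two Δ≡2
  by-Δ (suc (suc (suc F))) Δ≡E+1 = Δ-large (suc (suc F)) (s≤s (s≤s z≤n)) Δ≡E+1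

module StarCase {n : ℕ} (T : Adj n) (tree : IsTree T) (n≥2 : 2 ≤ n) (c : Fin n)
                (leaves : ∀ u → Edge T c u → deg T u ≡ 1) where

  private
    sym-T : ∀ u w → T u w ≡ T w u
    sym-T = proj₁ (proj₁ tree)
    loopless : ∀ u → T u u ≡ false
    loopless = proj₂ (proj₁ tree)

  open Induced T (T c) using (m; vertex; vertex-kept; index; vertex-index; index-vertex)

  neighbour : ∀ y → ¬ y ≡ c → Edge T c y
  neighbour y y≢c with star-around T tree c leaves y
  ... | inj₁ y≡c = ⊥-elim (y≢c y≡c)
  ... | inj₂ c~y = c~y

  vertex≢c : ∀ i → ¬ vertex i ≡ c
  vertex≢c i vi≡c = false≢true (trans (sym (loopless c)) (subst (Edge T c) vi≡c (vertex-kept i)))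

  to-star : Fin n → Fin (suc m)
  to-star y with y ≟ c
  ... | yes _ = zero
  ... | no y≢c = suc (index y (neighbour y y≢c))

  from-star : Fin (suc m) → Fin n
  from-star zero = c
  from-star (suc i) = vertex i

  iso : Iso T (star m)
  iso = record { to = to-star ; from = from-star ; to-from = to-from ; from-to = from-to ; preserve = preserve }
    where
    to-from : ∀ y → to-star (from-star y) ≡ y
    to-from zero with c ≟ c
    ... | yes _ = refl
    ... | no c≢c = ⊥-elim (c≢c refl)
    to-from (suc i) with vertex i ≟ c
    ... | yes vi≡c = ⊥-elim (vertex≢c i vi≡c)
    ... | no _ = cong suc (index-vertex i _)
    from-to : ∀ x → from-star (to-star x) ≡ x
    from-to x with x ≟ c
    ... | yes x≡c = sym x≡c
    ... | no _ = vertex-index x _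
    -- two leaves are never adjacent: each has c as its only neighbour
    preserve : ∀ u v → T u v ≡ star m (to-star u) (to-star v)
    preserve u v with u ≟ c | v ≟ c
    ... | yes refl | yes refl = loopless c
    ... | yes refl | no v≢c = neighbour v v≢c
    ... | no u≢c | yes refl = trans (sym-T u c) (neighbour u u≢c)
    ... | no u≢c | no v≢c with T u v in u~v
    ...   | false = refl
    ...   | true = ⊥-elim (v≢c (deg≤1-unique T u (≤-reflexive (leaves u (neighbour u u≢c))) u~v
                                   (trans (sym-T u c) (neighbour u u≢c))))

  m≥1 : 1 ≤ m
  m≥1 with deg≥1⇒edge T c (connected-deg≥1 T n≥2 (proj₁ (proj₂ tree)) c)
  ... | y , c~y = inhabited (index y c~y)
    where
    inhabited : ∀ {k} → Fin k → 1 ≤ k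
    inhabited {suc k} _ = s≤s z≤n

  built : Built T
  built = base m m≥1 tree iso

-- (⇒), deletion case: c is good and v is a non-leaf neighbour of c.  Then v
-- is the only non-leaf neighbour of c; let the pendant vertices be the leaf
-- neighbours of c and the rest be everything except c and the pendant
-- vertices.  The rest induces a tree T′ (retract c and the pendant vertices
-- onto v), and T is T′ with K_{1,p} attached at v, where p = d(c) = Δ(T).
module Deletion {n : ℕ} (T : Adj n) (tree : IsTree T) (n≥2 : 2 ≤ n) (sp-T : IsSp T (Δ T))
                (c : Fin n) (good : Good T c) (v : Fin n) (c~v : Edge T c v)
                (v-non-leaf : isLeaf T v ≡ false) where

  private
    sym-T : ∀ u w → T u w ≡ T w u
    sym-T = proj₁ (proj₁ tree)
    loopless : ∀ u → T u u ≡ false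
    loopless = proj₂ (proj₁ tree)
    deg≥1 : ∀ u → 1 ≤ deg T u
    deg≥1 = connected-deg≥1 T n≥2 (proj₁ (proj₂ tree))

  pendant : Fin n → Bool
  pendant u = T c u ∧ isLeaf T u

  rest : Fin n → Bool
  rest u = not (does (u ≟ c)) ∧ not (pendant u)

  module Rest = Induced T rest
  module Pendant = Induced T pendant

  m q p : ℕ
  m = Rest.m
  q = Pendant.m
  p = suc q

  T′ : Adj m
  T′ = Rest.T′

  only-v : ∀ u → Edge T c u → isLeaf T u ≡ false → u ≡ v
  only-v u c~u non-leaf = one-non-leaf-neighbour T c (≤-trans (≤-reflexive (proj₁ good)) (proj₂ good))
    c~u non-leaf c~v v-non-leaf

  pendant-only-c : ∀ y z → pendant y ≡ true → Edge T y z → z ≡ c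
  pendant-only-c y z py y~z = deg≤1-unique T y (≤-reflexive (leaf-deg T y (proj₂ (∧-true {T c y} py)))) y~z
    (trans (sym-T y c) (proj₁ (∧-true py)))

  rest-intro : ∀ y → ¬ y ≡ c → pendant y ≡ false → rest y ≡ true
  rest-intro y y≢c not-pendant rewrite does-≢ y≢c | not-pendant = refl

  rest⇒≢c : ∀ y → rest y ≡ true → ¬ y ≡ c
  rest⇒≢c y ry refl rewrite does-refl c = false≢true ry

  rest⇒¬pendant : ∀ y → rest y ≡ true → ¬ pendant y ≡ true
  rest⇒¬pendant y ry py rewrite py = false≢true (trans (sym (∧-zeroʳ (not (does (y ≟ c))))) ry)

  c-not-pendant : ¬ pendant c ≡ true
  c-not-pendant pc = false≢true (trans (sym (loopless c)) (proj₁ (∧-true pc)))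

  v-rest : rest v ≡ true
  v-rest = rest-intro v (λ { refl → false≢true (trans (sym (loopless c)) c~v) })
    (trans (cong (T c v ∧_) v-non-leaf) (∧-zeroʳ (T c v)))

  rest-neighbour : ∀ a → rest a ≡ true → Edge T a c → a ≡ v
  rest-neighbour a ra a~c = by-cases (isLeaf T a)
    (λ leaf-a → ⊥-elim (rest⇒¬pendant a ra (cong₂ _∧_ (trans (sym-T c a) a~c) leaf-a)))
    (only-v a (trans (sym-T c a) a~c))

  data Region (y : Fin n) : Set where
    in-rest : rest y ≡ true → Region y
    is-c : y ≡ c → Region y
    in-pendant : pendant y ≡ true → Region y

  region : ∀ y → Region y
  region y with y ≟ c
  ... | yes y≡c = is-c y≡c
  ... | no y≢c = by-cases (pendant y) in-pendant (in-rest ∘ rest-intro y y≢c)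

  π : Fin n → Fin n
  π y with region y
  ... | in-rest _ = y
  ... | is-c _ = v
  ... | in-pendant _ = v

  π-rest : ∀ y → rest (π y) ≡ true
  π-rest y with region y
  ... | in-rest ry = ry
  ... | is-c _ = v-rest
  ... | in-pendant _ = v-rest

  π-id : ∀ y → rest y ≡ true → π y ≡ y
  π-id y ry with region y
  ... | in-rest _ = refl
  ... | is-c y≡c = ⊥-elim (rest⇒≢c y ry y≡c)
  ... | in-pendant py = ⊥-elim (rest⇒¬pendant y ry py)

  π-edge : ∀ a b → Edge T a b → π a ≡ π b ⊎ Edge T (π a) (π b)
  π-edge a b e with region a | region b
  ... | in-rest _ | in-rest _ = inj₂ e
  ... | in-rest ra | is-c refl = inj₁ (rest-neighbour a ra e)
  ... | in-rest ra | in-pendant pb = ⊥-elim (rest⇒≢c a ra (pendant-only-c b a pb (trans (sym-T b a) e)))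
  ... | is-c refl | in-rest rb = inj₁ (sym (rest-neighbour b rb (trans (sym-T b c) e)))
  ... | is-c refl | is-c refl = ⊥-elim (false≢true (trans (sym (loopless c)) e))
  ... | is-c _ | in-pendant _ = inj₁ refl
  ... | in-pendant pa | in-rest rb = ⊥-elim (rest⇒≢c b rb (pendant-only-c a b pa e))
  ... | in-pendant _ | is-c _ = inj₁ refl
  ... | in-pendant pa | in-pendant pb = ⊥-elim (c-not-pendant (subst (λ z → pendant z ≡ true) (pendant-only-c a b pa e) pb))

  tree-T′ : IsTree T′
  tree-T′ = Rest.Retraction.tree′ π π-rest π-id π-edge tree

  v′ : Fin m
  v′ = Rest.index v v-rest

  to-sum : ∀ y → Region y → Fin m ⊎ Fin p
  to-sum y (in-rest ry) = inj₁ (Rest.index y ry)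
  to-sum y (is-c _) = inj₂ zero
  to-sum y (in-pendant py) = inj₂ (suc (Pendant.index y py))

  from-sum : Fin m ⊎ Fin p → Fin n
  from-sum (inj₁ a) = Rest.vertex a
  from-sum (inj₂ zero) = c
  from-sum (inj₂ (suc j)) = Pendant.vertex j

  to-sum-from-sum : ∀ s → to-sum (from-sum s) (region (from-sum s)) ≡ s
  to-sum-from-sum (inj₁ a) with region (Rest.vertex a)
  ... | in-rest ra = cong inj₁ (Rest.index-vertex a ra)
  ... | is-c a≡c = ⊥-elim (rest⇒≢c _ (Rest.vertex-kept a) a≡c)
  ... | in-pendant pa = ⊥-elim (rest⇒¬pendant _ (Rest.vertex-kept a) pa)
  to-sum-from-sum (inj₂ zero) with region c
  ... | in-rest rc = ⊥-elim (rest⇒≢c c rc refl)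
  ... | is-c _ = refl
  ... | in-pendant pc = ⊥-elim (c-not-pendant pc)
  to-sum-from-sum (inj₂ (suc j)) with region (Pendant.vertex j)
  ... | in-rest rj = ⊥-elim (rest⇒¬pendant _ rj (Pendant.vertex-kept j))
  ... | is-c j≡c = ⊥-elim (c-not-pendant (subst (λ z → pendant z ≡ true) j≡c (Pendant.vertex-kept j)))
  ... | in-pendant pj = cong (λ i → inj₂ (suc i)) (Pendant.index-vertex j pj)

  from-sum-to-sum : ∀ y (r : Region y) → from-sum (to-sum y r) ≡ y
  from-sum-to-sum y (in-rest ry) = Rest.vertex-index y ry
  from-sum-to-sum y (is-c y≡c) = sym y≡c
  from-sum-to-sum y (in-pendant py) = Pendant.vertex-index y py

  edge-to-c : ∀ y ry → T y c ≡ does (Rest.index y ry ≟ v′)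
  edge-to-c y ry with y ≟ v
  ... | yes refl = trans (trans (sym-T v c) c~v) (sym (dec-true (_ ≟ v′) (Rest.index-cong ry v-rest refl)))
  ... | no y≢v with T y c in y~c
  ...   | true = ⊥-elim (y≢v (rest-neighbour y ry y~c))
  ...   | false = sym (does-≢ (λ e → y≢v (trans (sym (Rest.vertex-index y ry))
                                         (trans (cong Rest.vertex e) (Rest.vertex-index v v-rest)))))

  no-edge : ∀ y z → pendant z ≡ true → ¬ y ≡ c → T y z ≡ false
  no-edge y z pz y≢c = ¬-not (λ y~z → y≢c (pendant-only-c z y pz (trans (sym-T z y) y~z)))

  preserve-sum : ∀ y z (ry : Region y) (rz : Region z) → T y z ≡ attachAdj T′ v′ (to-sum y ry) (to-sum z rz)
  preserve-sum y z (in-rest ry) (in-rest rz) = sym (cong₂ T (Rest.vertex-index y ry) (Rest.vertex-index z rz))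
  preserve-sum y z (in-rest ry) (is-c refl) = edge-to-c y ry
  preserve-sum y z (in-rest ry) (in-pendant pz) = no-edge y z pz (rest⇒≢c y ry)
  preserve-sum y z (is-c refl) (in-rest rz) = trans (sym-T c z) (edge-to-c z rz)
  preserve-sum y z (is-c refl) (is-c refl) = loopless c
  preserve-sum y z (is-c refl) (in-pendant pz) = proj₁ (∧-true pz)
  preserve-sum y z (in-pendant py) (in-rest rz) = trans (sym-T y z) (no-edge z y py (rest⇒≢c z rz))
  preserve-sum y z (in-pendant py) (is-c refl) = trans (sym-T y c) (proj₁ (∧-true py))
  preserve-sum y z (in-pendant py) (in-pendant pz) =
    no-edge y z pz (λ { refl → c-not-pendant py })

  iso : Iso T (attach T′ v′ p)
  iso = record { to = to ; from = from ; to-from = to-from ; from-to = from-to ; preserve = preserve }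
    where
    to : Fin n → Fin (m + p)
    to y = join m p (to-sum y (region y))
    from : Fin (m + p) → Fin n
    from x = from-sum (splitAt m x)
    to-from : ∀ x → to (from x) ≡ x
    to-from x = trans (cong (join m p) (to-sum-from-sum (splitAt m x))) (join-splitAt m p x)
    from-to : ∀ y → from (to y) ≡ y
    from-to y = trans (cong from-sum (splitAt-join m p (to-sum y (region y)))) (from-sum-to-sum y (region y))
    preserve : ∀ y z → T y z ≡ attach T′ v′ p (to y) (to z)
    preserve y z = trans (preserve-sum y z (region y) (region z))
      (sym (cong₂ (attachAdj T′ v′) (splitAt-join m p (to-sum y (region y))) (splitAt-join m p (to-sum z (region z)))))

  open Parts m q using (old; centre)
  module Attached = Glue T′ (λ i → does (i ≟ v′)) q

  deg-via-glue : ∀ y → deg T y ≡ deg Attached.G (Iso.to iso y)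
  deg-via-glue y = trans (deg-iso iso y) (deg-iso (attach-glue T′ v′ p) (Iso.to iso y))

  deg-rest : ∀ a → deg T (Rest.vertex a) ≡ deg T′ a + 𝟙 (does (a ≟ v′))
  deg-rest a = trans (deg-via-glue _) (trans (cong (deg Attached.G) (cong (join m p) (to-sum-from-sum (inj₁ a))))
    (Attached.deg-old a))

  deg-c : deg T c ≡ p
  deg-c = trans (deg-via-glue c) (trans (cong (deg Attached.G) (cong (join m p) (to-sum-from-sum (inj₂ zero))))
    (trans Attached.deg-centre (cong (_+ q) (∑-indicator v′))))

  deg-v : deg T v ≡ suc (deg T′ v′)
  deg-v = trans (cong (deg T) (sym (Rest.vertex-index v v-rest)))
    (trans (deg-rest v′) (trans (cong (λ b → deg T′ v′ + 𝟙 b) (does-refl v′)) (+-comm _ 1)))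

  p≡Δ : p ≡ Δ T
  p≡Δ = trans (sym deg-c) (proj₁ good)

  p≥2 : 2 ≤ p
  p≥2 = ≤-trans (non-leaf-deg T v (deg≥1 v) v-non-leaf) (≤-trans (deg≤Δ T v) (≤-reflexive (sym p≡Δ)))

  deg-T′≤p : ∀ a → deg T′ a ≤ p
  deg-T′≤p a = ≤-trans (m≤m+n (deg T′ a) _)
    (≤-trans (≤-reflexive (sym (deg-rest a))) (≤-trans (deg≤Δ T _) (≤-reflexive (sym p≡Δ))))

  m≥2 : 2 ≤ m
  m≥2 with deg≥1⇒edge T′ v′ (≤-pred (subst (2 ≤_) deg-v (non-leaf-deg T v (deg≥1 v) v-non-leaf)))
  ... | b , v′~b = two-distinct v′ b (λ { refl → false≢true (trans (sym (proj₂ (proj₁ tree-T′) v′)) v′~b) })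
    where
    two-distinct : ∀ {k} (a b : Fin k) → ¬ a ≡ b → 2 ≤ k
    two-distinct {suc zero} zero zero a≢b = ⊥-elim (a≢b refl)
    two-distinct {suc (suc k)} _ _ _ = s≤s (s≤s z≤n)

  -- Every witness for T′ extends to T, so sp(T′) ≥ Δ(T) = p; T′ itself
  -- shows sp(T′) ≤ Δ(T′) ≤ p.
  T′-least : ∀ j → HasSpanning T′ j → p ≤ j
  T′-least j witness = above-⊔ (subst (_≤ j ⊔ q) (sym p≡Δ) (proj₂ sp-T (j ⊔ q)
    (HasSpanning-iso iso _ (HasSpanning-iso (attach-glue T′ v′ p) _
      (glue-extend T′ (λ i → does (i ≟ v′)) q j (≤-pred p≥2) witness)))))
    where
    above-⊔ : suc q ≤ j ⊔ q → suc q ≤ j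
    above-⊔ h with ≤-total j q
    ... | inj₁ j≤q = ⊥-elim (1+n≰n (≤-trans h (≤-reflexive (m≤n⇒m⊔n≡n j≤q))))
    ... | inj₂ q≤j = ≤-trans h (≤-reflexive (m≥n⇒m⊔n≡m q≤j))

  deg-T′≥1 : ∀ a → 1 ≤ deg T′ a
  deg-T′≥1 = connected-deg≥1 T′ m≥2 (proj₁ (proj₂ tree-T′))

  sp-T′ : IsSp T′ p
  sp-T′ = (T′ , (proj₁ (proj₁ tree-T′) , λ a b e → e) , λ a → deg-T′≥1 a , deg-T′≤p a) , T′-least

  Δ-T′ : Δ T′ ≡ p
  Δ-T′ = ≤-antisym (Δ-lub T′ p deg-T′≤p) (T′-least (Δ T′) (HasSpanning-Δ T′ (proj₁ tree-T′) deg-T′≥1))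

  v′∈B : InB T′ v′
  v′∈B = ≤-trans (≤-reflexive (sym deg-v)) (≤-trans (deg≤Δ T v) (≤-reflexive (trans (sym p≡Δ) (sym Δ-T′))))

  -- a vertex of degree p ≥ 2 and its neighbours give at least three vertices
  m≥3 : 3 ≤ m
  m≥3 = below-pred m (≤-trans p≥2 (≤-trans (≤-reflexive (sym Δ-T′))
    (Δ-lub T′ (pred m) (λ a → pred-mono-≤ (deg<order T′ (proj₁ tree-T′) a)))))
    where
    below-pred : ∀ k → 2 ≤ pred k → 3 ≤ k
    below-pred (suc k) h = s≤s h

  -- T has m + p vertices and p ≥ 1
  m<n : m < n
  m<n = ≤-trans (≤-trans (≤-reflexive (+-comm 1 m)) (+-monoʳ-≤ m (≤-trans (s≤s z≤n) p≥2)))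
    (injective⇒≤ {f = Iso.from iso} (λ {x} {y} e → trans (sym (Iso.to-from iso x)) (trans (cong (Iso.to iso) e) (Iso.to-from iso y))))

  built : (∀ {k} → k < n → (S : Adj k) → 2 ≤ k → IsTree S → IsSp S (Δ S) → Built S) → Built T
  built rec = grow (rec m<n T′ m≥2 tree-T′ (subst (IsSp T′) (sym Δ-T′) sp-T′)) m≥3 p sp-T′ Δ-T′ p≥2 v′ v′∈B tree iso

sp⇒Built : ∀ {n} (T : Adj n) → 2 ≤ n → IsTree T → IsSp T (Δ T) → Built T
sp⇒Built {n} = <-rec (λ n → (T : Adj n) → 2 ≤ n → IsTree T → IsSp T (Δ T) → Built T) build n
  where
  build : ∀ n → (∀ {k} → k < n → (S : Adj k) → 2 ≤ k → IsTree S → IsSp S (Δ S) → Built S) →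
          (T : Adj n) → 2 ≤ n → IsTree T → IsSp T (Δ T) → Built T
  build n rec T n≥2 tree sp with good-vertex T tree n≥2 sp
  ... | c , good with any? (λ v → (T c v Bool.≟ true) ×-dec (isLeaf T v Bool.≟ false))
  ...   | yes (v , c~v , non-leaf) = Deletion.built T tree n≥2 sp c good v c~v non-leaf rec
  ...   | no none = StarCase.built T tree n≥2 c leaves
    where
    leaves : ∀ u → Edge T c u → deg T u ≡ 1
    leaves u c~u = by-cases (isLeaf T u) (leaf-deg T u) (λ non-leaf → ⊥-elim (none (u , c~u , non-leaf)))

mainTheorem10 : (n : ℕ) (T : Adj n) → 2 ≤ n → IsTree T →
  (IsSp T (Δ T) ⇔ Built T)
mainTheorem10 n T n≥2 tree = mk⇔ (sp⇒Built T n≥2 tree) Built⇒sp
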